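{- Let $v$ be a vertex, let $p$ be an $\mathrm{evenlevel}(v)$ path or an $\mathrm{oddlevel}(v)$ path, starting at unmatched vertex $f$, and let $u$ be a vertex on $p$ with $t(u)\ge t(v)$. Then $u$ is BFS-honest with respect to $p$. Furthermore, if $t(u)>t(v)$ then $|p[f\text{ to }u]|=\mathrm{minlevel}(u)$.
   Context: $G=(V,E)$ is a finite undirected graph with a matching $M$, and at least one vertex of $G$ is not covered by $M$ (is unmatched). An alternating path is a simple path whose edges alternate between edges not in $M$ (unmatched) and edges in $M$ (matched); an alternating path from an unmatched vertex starts with an unmatched edge. $\mathrm{evenlevel}(v)$ (resp. $\mathrm{oddlevel}(v)$) is the minimum length of an even (resp. odd) length alternating path from some unmatched vertex to $v$ ($\infty$ if none); any alternating path from an unmatched vertex to $v$ of this minimum even (resp. odd) length is called an $\mathrm{evenlevel}(v)$ (resp. $\mathrm{oddlevel}(v)$) path. $\mathrm{minlevel}(v)$ is the smaller of $\mathrm{evenlevel}(v),\mathrm{oddlevel}(v)$. The tenacity of a vertex is $t(v)=\mathrm{evenlevel}(v)+\mathrm{oddlevel}(v)$. For a path $p$ starting at $f$ and a vertex $u$ on $p$, $p[f\text{ to }u]$ is the subpath of $p$ from $f$ to $u$ and $|\cdot|$ denotes length; $u$ is even (odd) w.r.t. $p$ if $|p[f\text{ to }u]|$ is even (odd). $u$ is BFS-honest w.r.t. $p$ if $|p[f\text{ to }u]|=\mathrm{evenlevel}(u)$ when $u$ is even w.r.t. $p$, and $|p[f\text{ to }u]|=\mathrm{oddlevel}(u)$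 when $u$ is odd w.r.t. $p$. -}

module Defs where

open import Data.Nat using (ℕ; zero; suc; _+_; _≤_; _<_; _%_; _⊓_)
open import Data.Fin using (Fin; zero; suc; toℕ; inject₁)
open import Data.Vec using (Vec; lookup; last)
open import Data.Product using (Σ; _×_; ∃; ∃-syntax)
open import Data.Sum using (_⊎_)
open import Data.Empty using (⊥)
open import Relation.Nullary using (¬_)
open import Relation.Binary.PropositionalEquality using (_≡_)

record Graph (n : ℕ) : Set₁ where
  field
    Adj   : Fin n → Fin n → Set
    sym   : ∀ {u v} → Adj u v → Adj v u
    irrefl : ∀ {u} → ¬ Adj u u

record Matching {n : ℕ} (G : Graph n) : Set₁ where
  field
    M     : Fin n → Fin n → Set
    sub   : ∀ {u v} → M u v → Graph.Adj G u v
    sym   : ∀ {u v} → M u v → M v u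
    func  : ∀ {u v w} → M u v → M u w → v ≡ w

EvenN : ℕ → Set
EvenN k = k % 2 ≡ 0

OddN : ℕ → Set
OddN k = k % 2 ≡ 1

module _ {n : ℕ} {G : Graph n} (Mt : Matching G) where
  open Graph G
  open Matching Mt

  Unmatched : Fin n → Set
  Unmatched v = ∀ w → ¬ M v w

  -- An alternating path of length k from an unmatched vertex, given by its
  -- k+1 vertices p[0],...,p[k]: simple, consecutive vertices adjacent, edge i
  -- (from p[i] to p[i+1]) is matched iff i is odd (so it starts with an
  -- unmatched edge), and p[0] is unmatched.
  record AltPath {k : ℕ} (p : Vec (Fin n) (suc k)) : Set where
    field
      startFree : Unmatched (lookup p zero)
      simple    : ∀ i j → lookup p i ≡ lookup p j → i ≡ j
      edges     : ∀ (i : Fin k) → Adj (lookup p (inject₁ i)) (lookup p (suc i))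
      matchedIffOdd₁ : ∀ (i : Fin k) → M (lookup p (inject₁ i)) (lookup p (suc i)) → OddN (toℕ i)
      matchedIffOdd₂ : ∀ (i : Fin k) → OddN (toℕ i) → M (lookup p (inject₁ i)) (lookup p (suc i))

  AltPathTo : Fin n → ℕ → Set
  AltPathTo v k = Σ (Vec (Fin n) (suc k)) λ p → AltPath p × last p ≡ v

data ℕ∞ : Set where
  fin : ℕ → ℕ∞
  ∞   : ℕ∞

_+∞_ : ℕ∞ → ℕ∞ → ℕ∞
fin a +∞ fin b = fin (a + b)
fin a +∞ ∞ = ∞
∞ +∞ b = ∞

min∞ : ℕ∞ → ℕ∞ → ℕ∞
min∞ (fin a) (fin b) = fin (a ⊓ b)
min∞ (fin a) ∞ = fin a
min∞ ∞ b = b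

data _≤∞_ : ℕ∞ → ℕ∞ → Set where
  fin≤fin : ∀ {a b} → a ≤ b → fin a ≤∞ fin b
  x≤∞     : ∀ {x} → x ≤∞ ∞

data _<∞_ : ℕ∞ → ℕ∞ → Set where
  fin<fin : ∀ {a b} → a < b → fin a <∞ fin b
  fin<∞   : ∀ {a} → fin a <∞ ∞

module _ {n : ℕ} {G : Graph n} (Mt : Matching G) where

  IsMinLevel : (ℕ → Set) → Fin n → ℕ∞ → Set
  IsMinLevel P v (fin k) = P k × AltPathTo Mt v k × (∀ j → P j → AltPathTo Mt v j → k ≤ j)
  IsMinLevel P v ∞ = ∀ j → P j → ¬ AltPathTo Mt v j

  IsEvenLevel : (Fin n → ℕ∞) → Set
  IsEvenLevel el = ∀ v → IsMinLevel EvenN v (el v)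

  IsOddLevel : (Fin n → ℕ∞) → Set
  IsOddLevel ol = ∀ v → IsMinLevel OddN v (ol v)

-- Let p be a shortest alternating path of its parity from an unmatched vertex f to v, of length k, and
-- u = p[i]. If some alternating path Q to u of u's parity with respect to p were shorter than i, follow Q
-- until it first meets p[i..k], say at p[e]. If the meeting parities agree, Q followed by p[e..k] is a
-- path to v of v's parity of length < k, which is impossible; otherwise Q followed by p backwards from e
-- to i is a path to u of the other parity. In that case the tenacity bound t(v) ≤ t(u) lets us apply the
-- same splicing to a shortest path to v of the opposite parity, and every outcome contradicts a length
-- bound. The strict bound t(v) < t(u) rules out, by the same splicing, that u's other level is below i.
module Submission where

open import Defs
open import Data.Empty using (⊥-elim)
open import Data.Fin.Base using (Fin; zero; suc; toℕ; inject₁; fromℕ; fromℕ<)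
open import Data.Fin.Properties using (toℕ-injective; toℕ-fromℕ<; toℕ-inject₁; toℕ-fromℕ; toℕ≤pred[n]; toℕ<n)
  renaming (_≟_ to _≟ᶠ_)
open import Data.Nat.Base using (ℕ; zero; suc; _+_; _∸_; _≤_; _<_; _%_; z≤n; s≤s; z<s; parity)
open import Data.Nat.DivMod using (_mod_; m<n⇒m%n≡m)
open import Data.Nat.Properties
open import Data.Parity.Base as ℙ using (Parity; 0ℙ; 1ℙ; _⁻¹)
open import Data.Parity.Properties as ℙₚ using (+-homo-+; suc-homo-⁻¹; ⁻¹-selfInverse)
open import Data.Product using (Σ; _×_; _,_; proj₁; proj₂; ∃-syntax)
open import Data.Sum using (_⊎_; inj₁; inj₂)
open import Data.Vec using (Vec; lookup; last; tabulate; _∷_; [])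
open import Data.Vec.Properties using (lookup∘tabulate)
open import Function.Base using (_∘_)
open import Function.Bundles using (_⇔_; mk⇔; Equivalence)
open import Relation.Binary.PropositionalEquality
  using (_≡_; _≢_; refl; sym; trans; cong; subst; subst₂; module ≡-Reasoning)
open import Relation.Nullary using (¬_; yes; no)
open import Relation.Nullary.Decidable using (_×-dec_)
open import Relation.Unary using (Pred; Decidable)

open Equivalence using (to; from)

bit : Parity → ℕ
bit 0ℙ = 0
bit 1ℙ = 1

HasParity : Parity → ℕ → Set
HasParity p m = m % 2 ≡ bit p

%2≡bit∘parity : ∀ m → HasParity (parity m) m
%2≡bit∘parity 0 = refl
%2≡bit∘parity 1 = refl
%2≡bit∘parity (suc (suc m)) = %2≡bit∘parity m

bit-injective : ∀ {p q} → bit p ≡ bit q → p ≡ q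
bit-injective {0ℙ} {0ℙ} _ = refl
bit-injective {0ℙ} {1ℙ} ()
bit-injective {1ℙ} {0ℙ} ()
bit-injective {1ℙ} {1ℙ} _ = refl

HasParity⇒parity : ∀ m {p} → HasParity p m → parity m ≡ p
HasParity⇒parity m h = bit-injective (trans (sym (%2≡bit∘parity m)) h)

parity⇒HasParity : ∀ m {p} → parity m ≡ p → HasParity p m
parity⇒HasParity m refl = %2≡bit∘parity m

parity-suc : ∀ m → parity (suc m) ≡ parity m ⁻¹
parity-suc m = sym (⁻¹-selfInverse (suc-homo-⁻¹ m))

parity-+-assoc : ∀ b m x → b ℙ.+ parity (m + x) ≡ (b ℙ.+ parity m) ℙ.+ parity x
parity-+-assoc b m x = trans (cong (b ℙ.+_) (+-homo-+ m x)) (sym (ℙₚ.+-assoc b (parity m) (parity x)))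

≢⇒≡⁻¹ : ∀ {p q : Parity} → p ≢ q → p ≡ q ⁻¹
≢⇒≡⁻¹ {0ℙ} {0ℙ} p≢q = ⊥-elim (p≢q refl)
≢⇒≡⁻¹ {0ℙ} {1ℙ} _   = refl
≢⇒≡⁻¹ {1ℙ} {0ℙ} _   = refl
≢⇒≡⁻¹ {1ℙ} {1ℙ} p≢q = ⊥-elim (p≢q refl)

⁻¹-+-cancelʳ : ∀ p q → (p ℙ.+ q) ⁻¹ ℙ.+ q ≡ p ⁻¹
⁻¹-+-cancelʳ 0ℙ 0ℙ = refl
⁻¹-+-cancelʳ 0ℙ 1ℙ = refl
⁻¹-+-cancelʳ 1ℙ 0ℙ = refl
⁻¹-+-cancelʳ 1ℙ 1ℙ = refl

reverse-phase : ∀ b p q → b ℙ.+ p ≡ (b ℙ.+ (p ℙ.+ q ⁻¹)) ⁻¹ ℙ.+ q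
reverse-phase 0ℙ 0ℙ 0ℙ = refl
reverse-phase 0ℙ 0ℙ 1ℙ = refl
reverse-phase 0ℙ 1ℙ 0ℙ = refl
reverse-phase 0ℙ 1ℙ 1ℙ = refl
reverse-phase 1ℙ 0ℙ 0ℙ = refl
reverse-phase 1ℙ 0ℙ 1ℙ = refl
reverse-phase 1ℙ 1ℙ 0ℙ = refl
reverse-phase 1ℙ 1ℙ 1ℙ = refl

∸-suc : ∀ {m n} → n < m → m ∸ n ≡ suc (m ∸ suc n)
∸-suc {suc m} {zero}  _         = refl
∸-suc {suc m} {suc n} (s≤s n<m) = ∸-suc n<m

+-≤-exchange : ∀ {i t k o k′} → i + t ≤ k → o ≤ k′ + t → i + o ≤ k + k′
+-≤-exchange {i} {t} {k} {o} {k′} i+t≤k o≤k′+t = begin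
  i + o         ≤⟨ +-monoʳ-≤ i o≤k′+t ⟩
  i + (k′ + t)  ≡⟨ cong (i +_) (+-comm k′ t) ⟩
  i + (t + k′)  ≡⟨ +-assoc i t k′ ⟨
  i + t + k′    ≤⟨ +-monoˡ-≤ k′ i+t≤k ⟩
  k + k′        ∎
  where open ≤-Reasoning

data Split (d : ℕ) : ℕ → Set where
  before : ∀ {j} → j < d → Split d j
  after  : ∀ x → Split d (d + x)

split : ∀ d j → Split d j
split d j with j <? d
... | yes j<d = before j<d
... | no  j≮d = subst (Split d) (m+[n∸m]≡n (≮⇒≥ j≮d)) (after (j ∸ d))

module _ {p} {P : Pred ℕ p} (P? : Decidable P) where

  least-below : ∀ n → (∃[ m ] m < n × P m × (∀ {j} → j < m → ¬ P j)) ⊎ (∀ {j} → j < n → ¬ P j)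
  least-below zero = inj₂ λ ()
  least-below (suc n) with least-below n
  ... | inj₁ (m , m<n , Pm , below) = inj₁ (m , m<n⇒m<1+n m<n , Pm , below)
  ... | inj₂ none with P? n
  ...   | yes Pn = inj₁ (n , ≤-refl , Pn , none)
  ...   | no ¬Pn = inj₂ λ j<1+n → none-upto (m<1+n⇒m<n∨m≡n j<1+n)
    where
    none-upto : ∀ {j} → j < n ⊎ j ≡ n → ¬ P j
    none-upto (inj₁ j<n)  = none j<n
    none-upto (inj₂ refl) = ¬Pn

  least : ∀ {n} → P n → ∃[ m ] m ≤ n × P m × (∀ {j} → j < m → ¬ P j)
  least {n} Pn with least-below (suc n)
  ... | inj₁ (m , m<1+n , Pm , below) = m , ≤-pred m<1+n , Pm , below
  ... | inj₂ none = ⊥-elim (none ≤-refl Pn)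

module _ {A : Set} where

  join : ℕ → (ℕ → A) → (ℕ → A) → ℕ → A
  join d f g j with j ≤? d
  ... | yes _ = f j
  ... | no  _ = g (j ∸ d)

  join-≤ : ∀ {d f g j} → j ≤ d → join d f g j ≡ f j
  join-≤ {d} {j = j} j≤d with j ≤? d
  ... | yes _   = refl
  ... | no  j≰d = ⊥-elim (j≰d j≤d)

  join-+ : ∀ {d f g} → f d ≡ g 0 → ∀ x → join d f g (d + x) ≡ g x
  join-+ {d} {f} {g} fd≡g0 x with d + x ≤? d
  ... | no  _   = cong g (m+n∸m≡n d x)
  ... | yes d+x≤d with n≤0⇒n≡0 (+-cancelˡ-≤ d x 0 (subst (d + x ≤_) (sym (+-identityʳ d)) d+x≤d))
  ...   | refl = trans (cong f (+-identityʳ d)) fd≡g0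

last≡lookup-fromℕ : ∀ {A : Set} {k} (xs : Vec A (suc k)) → last xs ≡ lookup xs (fromℕ k)
last≡lookup-fromℕ {k = zero}  (x ∷ []) = refl
last≡lookup-fromℕ {k = suc k} (x ∷ xs) = last≡lookup-fromℕ xs

toℕ-mod : ∀ {a L} → a ≤ L → toℕ (a mod suc L) ≡ a
toℕ-mod a≤L = trans (toℕ-fromℕ< _) (m<n⇒m%n≡m (s≤s a≤L))

fin≤fin⁻¹ : ∀ {a b} → fin a ≤∞ fin b → a ≤ b
fin≤fin⁻¹ (fin≤fin a≤b) = a≤b

≤∞-trans : ∀ {x y z} → x ≤∞ y → y ≤∞ z → x ≤∞ z
≤∞-trans (fin≤fin x≤y) (fin≤fin y≤z) = fin≤fin (≤-trans x≤y y≤z)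
≤∞-trans _ x≤∞ = x≤∞

≤fin⇒fin : ∀ {x b} → x ≤∞ fin b → ∃[ a ] x ≡ fin a × a ≤ b
≤fin⇒fin (fin≤fin a≤b) = _ , refl , a≤b

fin+∞≤fin : ∀ {a b} x → (fin a +∞ x) ≤∞ fin b → ∃[ c ] x ≡ fin c × a + c ≤ b
fin+∞≤fin (fin c) (fin≤fin a+c≤b) = c , refl , a+c≤b

fin+∞<fin : ∀ {a b} x → (fin a +∞ x) <∞ fin b → ∃[ c ] x ≡ fin c × a + c < b
fin+∞<fin (fin c) (fin<fin a+c<b) = c , refl , a+c<b

+∞-comm : ∀ x y → x +∞ y ≡ y +∞ x
+∞-comm (fin a) (fin b) = cong fin (+-comm a b)
+∞-comm (fin a) ∞       = refl
+∞-comm ∞       (fin b) = refl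
+∞-comm ∞       ∞       = refl

min∞-fin-left : ∀ {m} y → (∀ {o} → y ≡ fin o → m ≤ o) → fin m ≡ min∞ (fin m) y
min∞-fin-left (fin o) m≤ = cong fin (sym (m≤n⇒m⊓n≡m (m≤ refl)))
min∞-fin-left ∞       _  = refl

min∞-fin-right : ∀ {m} y → (∀ {o} → y ≡ fin o → m ≤ o) → fin m ≡ min∞ y (fin m)
min∞-fin-right (fin o) m≤ = cong fin (sym (m≥n⇒m⊓n≡n (m≤ refl)))
min∞-fin-right ∞       _  = refl

module AlternatingPaths {n : ℕ} {G : Graph n} (Mt : Matching G) where
  open Graph G using (Adj) renaming (sym to Adj-sym)
  open Matching Mt using (M) renaming (sym to M-sym)

  AltEdge : Parity → Fin n → Fin n → Set
  AltEdge q a a′ = Adj a a′ × (M a a′ ⇔ q ≡ 1ℙ)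

  AltEdge-cong : ∀ {q q′ a a′ c c′} → a ≡ c → a′ ≡ c′ → q ≡ q′ → AltEdge q a a′ → AltEdge q′ c c′
  AltEdge-cong refl refl refl e = e

  AltEdge-sym : ∀ {q a a′} → AltEdge q a a′ → AltEdge q a′ a
  AltEdge-sym (adj , m⇔) = Adj-sym adj , mk⇔ (to m⇔ ∘ M-sym) (M-sym ∘ from m⇔)

  -- b is the parity of the position of g 0 on an alternating path from an unmatched vertex:
  -- edge x is matched iff b + x is odd.
  record AltSegment (b : Parity) (L : ℕ) (g : ℕ → Fin n) : Set where
    field
      injective : ∀ {x y} → x ≤ L → y ≤ L → g x ≡ g y → x ≡ y
      edge      : ∀ {x} → x < L → AltEdge (b ℙ.+ parity x) (g x) (g (suc x))

  open AltSegment

  -- AltPathTo with vertices indexed by ℕ (values beyond L are irrelevant), so that subpaths,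
  -- reversal and concatenation need no Fin arithmetic.
  record PathTo (v : Fin n) (L : ℕ) : Set where
    field
      at          : ℕ → Fin n
      unmatched₀  : Unmatched Mt (at 0)
      alternating : AltSegment 0ℙ L at
      at-end      : at L ≡ v

  open PathTo

  slice : ∀ {b L g} e {r} → e + r ≤ L → AltSegment b L g → AltSegment (b ℙ.+ parity e) r (λ x → g (e + x))
  slice {b} {g = g} e {r} e+r≤L S = record
    { injective = λ x≤r y≤r eq → +-cancelˡ-≡ e _ _ (injective S (inside x≤r) (inside y≤r) eq)
    ; edge      = λ {x} x<r → AltEdge-cong refl (cong g (sym (+-suc e x))) (parity-+-assoc b e x)
                                (edge S (<-≤-trans (+-monoʳ-< e x<r) e+r≤L))
    }
    where
    inside : ∀ {x} → x ≤ r → e + x ≤ _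
    inside x≤r = ≤-trans (+-monoʳ-≤ e x≤r) e+r≤L

  reverse : ∀ {b L g} → AltSegment b L g → AltSegment ((b ℙ.+ parity L) ⁻¹) L (λ x → g (L ∸ x))
  reverse {b} {L} {g} S = record { injective = injective′ ; edge = edge′ }
    where
    open ≡-Reasoning

    injective′ : ∀ {x y} → x ≤ L → y ≤ L → g (L ∸ x) ≡ g (L ∸ y) → x ≡ y
    injective′ {x} {y} x≤L y≤L eq = begin
      x            ≡⟨ m∸[m∸n]≡n x≤L ⟨
      L ∸ (L ∸ x)  ≡⟨ cong (L ∸_) (injective S (m∸n≤m L x) (m∸n≤m L y) eq) ⟩
      L ∸ (L ∸ y)  ≡⟨ m∸[m∸n]≡n y≤L ⟩
      y            ∎

    edge′ : ∀ {x} → x < L → AltEdge ((b ℙ.+ parity L) ⁻¹ ℙ.+ parity x) (g (L ∸ x)) (g (L ∸ suc x))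
    edge′ {x} x<L = AltEdge-cong (cong g (sym (∸-suc x<L))) refl phase (AltEdge-sym (edge S m<L))
      where
      m = L ∸ suc x
      m<L : m < L
      m<L = ∸-monoʳ-< z<s x<L
      phase : b ℙ.+ parity m ≡ (b ℙ.+ parity L) ⁻¹ ℙ.+ parity x
      phase = begin
        b ℙ.+ parity m                                     ≡⟨ reverse-phase b (parity m) (parity x) ⟩
        (b ℙ.+ (parity m ℙ.+ parity x ⁻¹)) ⁻¹ ℙ.+ parity x  ≡⟨ cong (λ q → (b ℙ.+ q) ⁻¹ ℙ.+ parity x) (begin
          parity m ℙ.+ parity x ⁻¹     ≡⟨ cong (parity m ℙ.+_) (parity-suc x) ⟨
          parity m ℙ.+ parity (suc x)  ≡⟨ +-homo-+ m (suc x) ⟨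
          parity (m + suc x)           ≡⟨ cong parity (m∸n+n≡m x<L) ⟩
          parity L                     ∎) ⟩
        (b ℙ.+ parity L) ⁻¹ ℙ.+ parity x                   ∎

  join-alternating : ∀ {b d r f g} → AltSegment b d f → AltSegment (b ℙ.+ parity d) r g → f d ≡ g 0
                   → (∀ {j x} → j < d → x ≤ r → f j ≢ g x) → AltSegment b (d + r) (join d f g)
  join-alternating {b} {d} {r} {f} {g} F R junction disjoint = record { injective = injective′ ; edge = edge′ }
    where
    left : ∀ {j} → j ≤ d → join d f g j ≡ f j
    left = join-≤ {d = d} {f} {g}

    right : ∀ x → join d f g (d + x) ≡ g x
    right = join-+ {d = d} {f} {g} junction

    injective′ : ∀ {a a′} → a ≤ d + r → a′ ≤ d + r → join d f g a ≡ join d f g a′ → a ≡ a′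
    injective′ {a} {a′} a≤ a′≤ eq with split d a | split d a′
    ... | before a<d | before a′<d =
          injective F (<⇒≤ a<d) (<⇒≤ a′<d) (trans (sym (left (<⇒≤ a<d))) (trans eq (left (<⇒≤ a′<d))))
    ... | before a<d | after x′ =
          ⊥-elim (disjoint a<d (+-cancelˡ-≤ d x′ r a′≤) (trans (sym (left (<⇒≤ a<d))) (trans eq (right x′))))
    ... | after x | before a′<d =
          ⊥-elim (disjoint a′<d (+-cancelˡ-≤ d x r a≤) (trans (sym (left (<⇒≤ a′<d))) (trans (sym eq) (right x))))
    ... | after x | after x′ =
          cong (d +_) (injective R (+-cancelˡ-≤ d x r a≤) (+-cancelˡ-≤ d x′ r a′≤)
                        (trans (sym (right x)) (trans eq (right x′))))

    edge′ : ∀ {a} → a < d + r → AltEdge (b ℙ.+ parity a) (join d f g a) (join d f g (suc a))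
    edge′ {a} a< with split d a
    ... | before a<d = AltEdge-cong (sym (left (<⇒≤ a<d))) (sym (left a<d)) refl (edge F a<d)
    ... | after x    = AltEdge-cong (sym (right x)) (sym (trans (cong (join d f g) (sym (+-suc d x))) (right (suc x))))
                         (sym (parity-+-assoc b d x)) (edge R (+-cancelˡ-< d x r a<))

  prefix : ∀ {v k i} (P : PathTo v k) → i ≤ k → PathTo (at P i) i
  prefix P i≤k = record
    { at = at P ; unmatched₀ = unmatched₀ P ; alternating = slice 0 i≤k (alternating P) ; at-end = refl }

  graft : ∀ {w L d r g} (S : PathTo w L) → d ≤ L → AltSegment (parity d) r g → at S d ≡ g 0
        → (∀ {j x} → j < d → x ≤ r → at S j ≢ g x) → PathTo (g r) (d + r)
  graft {d = d} {g = g} S d≤L tail junction disjoint = record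
    { at          = join d (at S) g
    ; unmatched₀  = subst (Unmatched Mt) (sym (join-≤ {d = d} {at S} {g} z≤n)) (unmatched₀ S)
    ; alternating = join-alternating (slice 0 d≤L (alternating S)) tail junction disjoint
    ; at-end      = join-+ {d = d} {at S} {g} junction _
    }

  module _ {L : ℕ} (p : Vec (Fin n) (suc L)) where

    vertexAt : ℕ → Fin n
    vertexAt a = lookup p (a mod suc L)

    vertexAt-≡ : ∀ {j a} → toℕ j ≡ a → vertexAt a ≡ lookup p j
    vertexAt-≡ {j} refl = cong (lookup p) (toℕ-injective (toℕ-mod (toℕ≤pred[n] j)))

    fromVec : ∀ {v} → AltPath Mt p → last p ≡ v → PathTo v L
    fromVec {v} A end = record
      { at          = vertexAt
      ; unmatched₀  = AltPath.startFree A
      ; alternating = record { injective = injective′ ; edge = edge′ }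
      ; at-end      = trans (vertexAt-≡ (toℕ-fromℕ L)) (trans (sym (last≡lookup-fromℕ p)) end)
      }
      where
      injective′ : ∀ {x y} → x ≤ L → y ≤ L → vertexAt x ≡ vertexAt y → x ≡ y
      injective′ x≤L y≤L eq =
        trans (sym (toℕ-mod x≤L)) (trans (cong toℕ (AltPath.simple A _ _ eq)) (toℕ-mod y≤L))

      vecEdge : (i : Fin L) → AltEdge (parity (toℕ i)) (lookup p (inject₁ i)) (lookup p (suc i))
      vecEdge i = AltPath.edges A i
                , mk⇔ (HasParity⇒parity (toℕ i) ∘ AltPath.matchedIffOdd₁ A i)
                      (AltPath.matchedIffOdd₂ A i ∘ parity⇒HasParity (toℕ i))

      edge′ : ∀ {x} → x < L → AltEdge (parity x) (vertexAt x) (vertexAt (suc x))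
      edge′ x<L = AltEdge-cong (sym (vertexAt-≡ (trans (toℕ-inject₁ _) (toℕ-fromℕ< x<L))))
                               (sym (vertexAt-≡ (cong suc (toℕ-fromℕ< x<L))))
                               (cong parity (toℕ-fromℕ< x<L))
                               (vecEdge (fromℕ< x<L))

  toVec : ∀ {v L} → PathTo v L → AltPathTo Mt v L
  toVec {v} {L} P = tabulate (at P ∘ toℕ) , record
    { startFree      = unmatched₀ P
    ; simple         = λ i j eq → toℕ-injective (injective (alternating P) (toℕ≤pred[n] i) (toℕ≤pred[n] j)
                         (trans (sym (lookup∘tabulate (at P ∘ toℕ) i)) (trans eq (lookup∘tabulate (at P ∘ toℕ) j))))
    ; edges          = proj₁ ∘ tabEdge
    ; matchedIffOdd₁ = λ i → parity⇒HasParity (toℕ i) ∘ to (proj₂ (tabEdge i))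
    ; matchedIffOdd₂ = λ i → from (proj₂ (tabEdge i)) ∘ HasParity⇒parity (toℕ i)
    }
    , trans (last≡lookup-fromℕ tab)
        (trans (lookup∘tabulate (at P ∘ toℕ) (fromℕ L)) (trans (cong (at P) (toℕ-fromℕ L)) (at-end P)))
    where
    tab = tabulate (at P ∘ toℕ)

    tabEdge : (i : Fin L) → AltEdge (parity (toℕ i)) (lookup tab (inject₁ i)) (lookup tab (suc i))
    tabEdge i = AltEdge-cong (sym (trans (lookup∘tabulate (at P ∘ toℕ) (inject₁ i)) (cong (at P) (toℕ-inject₁ i))))
                             (sym (lookup∘tabulate (at P ∘ toℕ) (suc i))) refl (edge (alternating P) (toℕ<n i))

  record FirstMeet {v w k L} (P : PathTo v k) (S : PathTo w L) (i : ℕ) : Set where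
    field
      d e   : ℕ
      d≤L   : d ≤ L
      i≤e   : i ≤ e
      e≤k   : e ≤ k
      meet  : at S d ≡ at P e
      avoid : ∀ {j x} → j < d → i ≤ x → x ≤ k → at S j ≢ at P x

  first-meet : ∀ {v w k L i c} (P : PathTo v k) (S : PathTo w L) → i ≤ c → c ≤ k → at P c ≡ w
             → FirstMeet P S i
  first-meet {k = k} {i = i} {c} P S i≤c c≤k end
    with least meets? (c , s≤s c≤k , i≤c , trans (at-end S) (sym end))
    where
    meets? : Decidable (λ j → ∃[ x ] x < suc k × i ≤ x × at S j ≡ at P x)
    meets? j = anyUpTo? (λ x → (i ≤? x) ×-dec (at S j ≟ᶠ at P x)) (suc k)
  ... | d , d≤L , (e , s≤s e≤k , i≤e , meet) , earlier = record
    { d = d ; e = e ; d≤L = d≤L ; i≤e = i≤e ; e≤k = e≤k ; meet = meet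
    ; avoid = λ j<d i≤x x≤k eq → earlier j<d (_ , s≤s x≤k , i≤x , eq) }

  data Splice {v k} (P : PathTo v k) (i L : ℕ) : Set where
    to-end    : ∀ d r → d ≤ L → i + r ≤ k → parity (d + r) ≡ parity k → PathTo v (d + r) → Splice P i L
    to-vertex : ∀ d t → d ≤ L → i + t ≤ k → parity (d + t) ≡ parity i ⁻¹ → PathTo (at P i) (d + t)
              → Splice P i L

  module _ {v w k L i} (P : PathTo v k) (S : PathTo w L) (m : FirstMeet P S i) where
    open FirstMeet m
    open ≡-Reasoning

    splice-to-end : parity d ≡ parity e → Splice P i L
    splice-to-end same =
      to-end d r d≤L (≤-trans (+-monoˡ-≤ r i≤e) (≤-reflexive e+r≡k)) parity-d+r
        (subst (λ x → PathTo x (d + r)) (trans (cong (at P) e+r≡k) (at-end P))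
          (graft S d≤L tail (trans meet (cong (at P) (sym (+-identityʳ e)))) disjoint))
      where
      r = k ∸ e
      e+r≡k : e + r ≡ k
      e+r≡k = m+[n∸m]≡n e≤k

      tail : AltSegment (parity d) r (λ x → at P (e + x))
      tail = subst (λ q → AltSegment q r (λ x → at P (e + x))) (sym same) (slice e (≤-reflexive e+r≡k) (alternating P))

      disjoint : ∀ {j x} → j < d → x ≤ r → at S j ≢ at P (e + x)
      disjoint j<d x≤r = avoid j<d (≤-trans i≤e (m≤m+n e _)) (≤-trans (+-monoʳ-≤ e x≤r) (≤-reflexive e+r≡k))

      parity-d+r : parity (d + r) ≡ parity k
      parity-d+r = begin
        parity (d + r)          ≡⟨ +-homo-+ d r ⟩
        parity d ℙ.+ parity r   ≡⟨ cong (ℙ._+ parity r) same ⟩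
        parity e ℙ.+ parity r   ≡⟨ +-homo-+ e r ⟨
        parity (e + r)          ≡⟨ cong parity e+r≡k ⟩
        parity k                ∎

    splice-to-vertex : parity d ≢ parity e → Splice P i L
    splice-to-vertex differ =
      to-vertex d t d≤L i+t≤k parity-d+t
        (subst (λ x → PathTo x (d + t)) (cong (at P) (trans (cong (i +_) (n∸n≡0 t)) (+-identityʳ i)))
          (graft S d≤L tail (trans meet (cong (at P) (sym i+t≡e))) disjoint))
      where
      t = e ∸ i
      i+t≡e : i + t ≡ e
      i+t≡e = m+[n∸m]≡n i≤e
      i+t≤k : i + t ≤ k
      i+t≤k = ≤-trans (≤-reflexive i+t≡e) e≤k

      phase : (parity i ℙ.+ parity t) ⁻¹ ≡ parity d
      phase = begin
        (parity i ℙ.+ parity t) ⁻¹  ≡⟨ cong _⁻¹ (+-homo-+ i t) ⟨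
        parity (i + t) ⁻¹           ≡⟨ cong (λ x → parity x ⁻¹) i+t≡e ⟩
        parity e ⁻¹                 ≡⟨ ≢⇒≡⁻¹ differ ⟨
        parity d                    ∎

      tail : AltSegment (parity d) t (λ x → at P (i + (t ∸ x)))
      tail = subst (λ q → AltSegment q t (λ x → at P (i + (t ∸ x)))) phase (reverse (slice i i+t≤k (alternating P)))

      disjoint : ∀ {j x} → j < d → x ≤ t → at S j ≢ at P (i + (t ∸ x))
      disjoint {x = x} j<d _ = avoid j<d (m≤m+n i _) (≤-trans (+-monoʳ-≤ i (m∸n≤m t x)) i+t≤k)

      parity-d+t : parity (d + t) ≡ parity i ⁻¹
      parity-d+t = begin
        parity (d + t)                          ≡⟨ +-homo-+ d t ⟩
        parity d ℙ.+ parity t                   ≡⟨ cong (ℙ._+ parity t) phase ⟨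
        (parity i ℙ.+ parity t) ⁻¹ ℙ.+ parity t  ≡⟨ ⁻¹-+-cancelʳ (parity i) (parity t) ⟩
        parity i ⁻¹                             ∎

  -- Follow S up to its first meeting with P[i..k]; the parities at the meeting point decide
  -- whether to continue forwards to v or backwards to P[i].
  splice : ∀ {v w k L i c} (P : PathTo v k) (S : PathTo w L) → i ≤ c → c ≤ k → at P c ≡ w → Splice P i L
  splice P S i≤c c≤k end with first-meet P S i≤c c≤k end
  ... | m with parity (FirstMeet.d m) ℙₚ.≟ parity (FirstMeet.e m)
  ...   | yes same   = splice-to-end P S m same
  ...   | no  differ = splice-to-vertex P S m differ

module Levels {n : ℕ} {G : Graph n} (Mt : Matching G) (el ol : Fin n → ℕ∞)
              (evenlevel : IsEvenLevel Mt el) (oddlevel : IsOddLevel Mt ol) where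
  open AlternatingPaths Mt
  open PathTo

  level : Parity → Fin n → ℕ∞
  level 0ℙ = el
  level 1ℙ = ol

  tenacity : Fin n → ℕ∞
  tenacity w = el w +∞ ol w

  level-spec : ∀ p w → IsMinLevel Mt (HasParity p) w (level p w)
  level-spec 0ℙ = evenlevel
  level-spec 1ℙ = oddlevel

  level-≤ : ∀ {p w L} → parity L ≡ p → PathTo w L → level p w ≤∞ fin L
  level-≤ {p} {w} {L} par P = bound (level p w) (level-spec p w)
    where
    bound : ∀ x → IsMinLevel Mt (HasParity p) w x → x ≤∞ fin L
    bound (fin m) (_ , _ , minimal) = fin≤fin (minimal L (parity⇒HasParity L par) (toVec P))
    bound ∞       none              = ⊥-elim (none L (parity⇒HasParity L par) (toVec P))

  level-path : ∀ {p w m} → level p w ≡ fin m → PathTo w m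
  level-path {p} {w} eq with subst (IsMinLevel Mt (HasParity p) w) eq (level-spec p w)
  ... | _ , (q , Q , end) , _ = fromVec q Q end

  level-min : ∀ {p w L m} → parity L ≡ p → level p w ≡ fin m → PathTo w L → m ≤ L
  level-min par eq P = fin≤fin⁻¹ (subst (_≤∞ _) eq (level-≤ par P))

  tenacity-via : ∀ {p w a} → level p w ≡ fin a → tenacity w ≡ fin a +∞ level (p ⁻¹) w
  tenacity-via {0ℙ} eq = cong (_+∞ _) eq
  tenacity-via {1ℙ} {w} eq = trans (+∞-comm (el w) (ol w)) (cong (_+∞ _) eq)

  tenacity-fin : ∀ {p w a b} → level p w ≡ fin a → level (p ⁻¹) w ≡ fin b → tenacity w ≡ fin (a + b)
  tenacity-fin {a = a} eqa eqb = trans (tenacity-via eqa) (cong (fin a +∞_) eqb)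

  level-parity : ∀ {w} m {x} → (EvenN m × el w ≡ x) ⊎ (OddN m × ol w ≡ x) → level (parity m) w ≡ x
  level-parity {w} m {x} (inj₁ (even , eq)) = subst (λ p → level p w ≡ x) (sym (HasParity⇒parity m even)) eq
  level-parity {w} m {x} (inj₂ (odd , eq))  = subst (λ p → level p w ≡ x) (sym (HasParity⇒parity m odd)) eq

  BFSHonest : Fin n → ℕ → Set
  BFSHonest w m = (EvenN m → el w ≡ fin m) × (OddN m → ol w ≡ fin m)

  parity-level : ∀ {w m} → level (parity m) w ≡ fin m → BFSHonest w m
  parity-level {w} {m} eq = (λ even → subst (λ p → level p w ≡ fin m) (HasParity⇒parity m even) eq)
                          , (λ odd → subst (λ p → level p w ≡ fin m) (HasParity⇒parity m odd) eq)

  level-minimal : ∀ {p w m} → level p w ≡ fin m → (∀ {o} → level (p ⁻¹) w ≡ fin o → m ≤ o)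
                → fin m ≡ min∞ (el w) (ol w)
  level-minimal {0ℙ} {w} {m} eq m≤ = subst (λ x → fin m ≡ min∞ x (ol w)) (sym eq) (min∞-fin-left (ol w) m≤)
  level-minimal {1ℙ} {w} {m} eq m≤ = subst (λ x → fin m ≡ min∞ (el w) x) (sym eq) (min∞-fin-right (el w) m≤)

  module _ {v k} (P : PathTo v k) (v-level : level (parity k) v ≡ fin k) {i} (i≤k : i ≤ k) where

    detour : ∀ {w L c} → PathTo w L → at P c ≡ w → i ≤ c → c ≤ k
           → i ≤ L ⊎ ∃[ t ] i + t ≤ k × level (parity i ⁻¹) (at P i) ≤∞ fin (L + t)
    detour S end i≤c c≤k with splice P S i≤c c≤k end
    ... | to-end d r d≤L i+r≤k same Q =
          inj₁ (≤-trans (+-cancelʳ-≤ r i d (≤-trans i+r≤k (level-min same v-level Q))) d≤L)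
    ... | to-vertex d t d≤L i+t≤k opposite Q =
          inj₂ (t , i+t≤k , ≤∞-trans (level-≤ opposite Q) (fin≤fin (+-monoˡ-≤ t d≤L)))

    detour-via-v : ∀ {k′} → level (parity k ⁻¹) v ≡ fin k′
                  → i ≤ k′ ⊎ (∀ {o} → level (parity i ⁻¹) (at P i) ≡ fin o → i + o ≤ k + k′)
    detour-via-v eq with detour (level-path eq) (at-end P) i≤k ≤-refl
    ... | inj₁ i≤k′ = inj₁ i≤k′
    ... | inj₂ (t , i+t≤k , bound) = inj₂ λ eqo → +-≤-exchange i+t≤k (fin≤fin⁻¹ (subst (_≤∞ _) eqo bound))

    honest : tenacity v ≤∞ tenacity (at P i) → level (parity i) (at P i) ≡ fin i
    honest T with ≤fin⇒fin (level-≤ refl (prefix P i≤k))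
    ... | ℓ , ℓ-eq , ℓ≤i = trans ℓ-eq (cong fin (≤-antisym ℓ≤i (≮⇒≥ ℓ≮i)))
      where
      ℓ≮i : ¬ ℓ < i
      ℓ≮i ℓ<i with detour (level-path ℓ-eq) refl ≤-refl i≤k
      ... | inj₁ i≤ℓ = <⇒≱ ℓ<i i≤ℓ
      ... | inj₂ (t , i+t≤k , bound) with ≤fin⇒fin bound
      ... | o , o-eq , o≤ℓ+t
            with fin+∞≤fin _ (subst₂ _≤∞_ (tenacity-via v-level) (tenacity-fin ℓ-eq o-eq) T)
      ... | k′ , k′-eq , k+k′≤ℓ+o with detour-via-v k′-eq
      ... | inj₂ short = <⇒≱ ℓ<i (+-cancelʳ-≤ o i ℓ (≤-trans (short o-eq) k+k′≤ℓ+o))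
      ... | inj₁ i≤k′ = <-irrefl refl (begin-strict
            ℓ + (ℓ + t)  <⟨ +-mono-< ℓ<i (+-monoˡ-< t ℓ<i) ⟩
            i + (i + t)  ≤⟨ +-monoˡ-≤ (i + t) i≤k′ ⟩
            k′ + (i + t) ≡⟨ +-comm k′ (i + t) ⟩
            i + t + k′   ≤⟨ +-monoˡ-≤ k′ i+t≤k ⟩
            k + k′       ≤⟨ k+k′≤ℓ+o ⟩
            ℓ + o        ≤⟨ +-monoʳ-≤ ℓ o≤ℓ+t ⟩
            ℓ + (ℓ + t)  ∎)
        where open ≤-Reasoning

    other-level-≥ : tenacity v <∞ tenacity (at P i) → level (parity i) (at P i) ≡ fin i
                  → ∀ {o} → level (parity i ⁻¹) (at P i) ≡ fin o → i ≤ o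
    other-level-≥ T i-eq o-eq
      with fin+∞<fin _ (subst₂ _<∞_ (tenacity-via v-level) (tenacity-fin i-eq o-eq) T)
    ... | k′ , k′-eq , k+k′<i+o with detour-via-v k′-eq
    ... | inj₁ i≤k′ = <⇒≤ (+-cancelˡ-< i i _ (≤-<-trans (+-mono-≤ i≤k i≤k′) k+k′<i+o))
    ... | inj₂ short = ⊥-elim (<⇒≱ k+k′<i+o (short o-eq))

    tenacious-vertex-honest : tenacity v ≤∞ tenacity (at P i)
      → BFSHonest (at P i) i × (tenacity v <∞ tenacity (at P i) → fin i ≡ min∞ (el (at P i)) (ol (at P i)))
    tenacious-vertex-honest T = parity-level i-eq , λ T< → level-minimal i-eq (other-level-≥ T< i-eq)
      where
      i-eq = honest T

theorem1 : ∀ {n : ℕ} (G : Graph n) (Mt : Matching G)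
    → Σ (Fin n) (λ w → Unmatched Mt w)
    → (el ol : Fin n → ℕ∞) → IsEvenLevel Mt el → IsOddLevel Mt ol
    → (v : Fin n) (k : ℕ) (p : Vec (Fin n) (suc k)) → AltPath Mt p → last p ≡ v
    → ((EvenN k × el v ≡ fin k) ⊎ (OddN k × ol v ≡ fin k))
    → (i : Fin (suc k))
    → (el v +∞ ol v) ≤∞ (el (lookup p i) +∞ ol (lookup p i))
    → ((EvenN (toℕ i) → el (lookup p i) ≡ fin (toℕ i))
        × (OddN (toℕ i) → ol (lookup p i) ≡ fin (toℕ i)))
      × ((el v +∞ ol v) <∞ (el (lookup p i) +∞ ol (lookup p i))
        → fin (toℕ i) ≡ min∞ (el (lookup p i)) (ol (lookup p i)))
theorem1 G Mt _ el ol evenlevel oddlevel v k p A end v-level i =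
  subst (λ u → tenacity v ≤∞ tenacity u
               → BFSHonest u (toℕ i) × (tenacity v <∞ tenacity u → fin (toℕ i) ≡ min∞ (el u) (ol u)))
        (vertexAt-≡ p refl)
        (tenacious-vertex-honest (fromVec p A end) (level-parity k v-level) (toℕ≤pred[n] i))
  where
  open AlternatingPaths Mt
  open Levels Mt el ol evenlevel oddlevel
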